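{- (Subdistributivity) Let $S$ be a solid and let $x,y,z\in S$. Then $x(y+z)\le xy+xz$.
   Context: A solid is a set $S$ with binary operations $+$ and $\cdot$ and a relation $\le$ satisfying: (1) $+$ is associative and commutative; for every $x$ there is a unique $e$ with $x+e=x$ and $e+f=e$ whenever $x+f=x$, written $e(x)$ (the magnitude of $x$); for every $x$ there is $s$ with $x+s=e(x)$ and $e(s)=e(x)$, written $-x$; $e(x+y)=e(x)$ or $e(x+y)=e(y)$. (2) $\cdot$ is associative and commutative; for every $x\ne e(x)$ there is a unique $u$ with $xu=x$ and $uv=u$ whenever $xv=x$, written $u(x)$; for every $x\ne e(x)$ there is $d$ with $xd=u(x)$ and $u(d)=u(x)$, written $x^{ -1}$; for $x\ne e(x),y\ne e(y)$: $u(xy)=u(x)$ or $u(xy)=u(y)$. (3) $\le$ is a total order; $x\le y\Rightarrow x+z\le y+z$; $y+e(x)=e(x)\Rightarrow (y\le e(x)$ and $-y\le e(x))$; $(e(x)<x$ and $y\le z)\Rightarrow xy\le xz$; $e(y)\le y\le z\Rightarrow e(x)y\le e(x)z$. (4) For all $x,y$ there is $z$ with $e(x)y=e(z)$; $e(xy)=e(x)y+e(y)x$; for $x\ne e(x)$, $e(u(x))=e(x)x^{ -1}$; $xy+xz=x(y+z)+e(x)y+e(x)z$; $-(xy)=(-x)y$. (5) There is $0$ with $0+x=x$ for all $x$; there is $1$ with $1x=x$ for all $x$; there is $M$ with $e(x)+M=M$ for all $x$; there is $x$ with $e(x)\ne 0$ and $e(x)\ne M$; for every $x$ there is $a$ with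 $x=a+e(x)$ and $e(a)=0$; if $x=e(x)$, $y=e(y)$ and $x<y$ then there is $z\ne e(z)$ with $x<z<y$. -}

module Defs where

open import Level using (Level; _⊔_; suc)
open import Data.Product using (Σ; _×_; _,_)
open import Data.Sum using (_⊎_)
open import Relation.Nullary using (¬_)
open import Relation.Binary.PropositionalEquality using (_≡_; _≢_)
open import Relation.Binary.Definitions using (Total)
open import Relation.Binary.Structures using (IsTotalOrder)

-- Equality is propositional equality on the carrier.
-- "there is a unique e with P e" is rendered as a function e together with
-- P (e x) and uniqueness; partial operations (u, ⁻¹, defined only for
-- x ≠ e(x)) take a proof of x ≢ e x.
record Solid (a ℓ : Level) : Set (suc (a ⊔ ℓ)) where
  infixl 6 _+_
  infixl 7 _·_
  infix 4 _≤_ _<_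
  field
    S   : Set a
    _+_ : S → S → S
    _·_ : S → S → S
    _≤_ : S → S → Set ℓ

  _<_ : S → S → Set (a ⊔ ℓ)
  x < y = (x ≤ y) × (x ≢ y)

  field
    +-assoc : ∀ x y z → (x + y) + z ≡ x + (y + z)
    +-comm  : ∀ x y → x + y ≡ y + x
    e       : S → S
    e-neutral : ∀ x → x + e x ≡ x
    e-min     : ∀ x f → x + f ≡ x → e x + f ≡ e x
    e-unique  : ∀ x e′ → x + e′ ≡ x → (∀ f → x + f ≡ x → e′ + f ≡ e′) → e′ ≡ e x
    -_        : S → S
    neg-inv   : ∀ x → x + (- x) ≡ e x
    neg-mag   : ∀ x → e (- x) ≡ e x
    e-+       : ∀ x y → (e (x + y) ≡ e x) ⊎ (e (x + y) ≡ e y)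
    ·-assoc : ∀ x y z → (x · y) · z ≡ x · (y · z)
    ·-comm  : ∀ x y → x · y ≡ y · x
    u       : (x : S) → x ≢ e x → S
    u-neutral : ∀ x (p : x ≢ e x) → x · u x p ≡ x
    u-min     : ∀ x (p : x ≢ e x) v → x · v ≡ x → u x p · v ≡ u x p
    u-unique  : ∀ x (p : x ≢ e x) u′ → x · u′ ≡ x → (∀ v → x · v ≡ x → u′ · v ≡ u′) → u′ ≡ u x p
    inv       : (x : S) → x ≢ e x → S
    inv-inv   : ∀ x (p : x ≢ e x) → x · inv x p ≡ u x p
    inv-unit  : ∀ x (p : x ≢ e x) → Σ (inv x p ≢ e (inv x p)) (λ q → u (inv x p) q ≡ u x p)
    u-·       : ∀ x y (p : x ≢ e x) (q : y ≢ e y) (r : x · y ≢ e (x · y)) →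
                (u (x · y) r ≡ u x p) ⊎ (u (x · y) r ≡ u y q)
    ≤-isTotalOrder : IsTotalOrder _≡_ _≤_
    +-mono-≤  : ∀ x y z → x ≤ y → x + z ≤ y + z
    absorbed  : ∀ x y → y + e x ≡ e x → (y ≤ e x) × (- y ≤ e x)
    ·-mono-≤  : ∀ x y z → e x < x → y ≤ z → x · y ≤ x · z
    e·-mono-≤ : ∀ x y z → e y ≤ y → y ≤ z → e x · y ≤ e x · z
    e·-mag    : ∀ x y → Σ S (λ z → e x · y ≡ e z)
    e-·       : ∀ x y → e (x · y) ≡ e x · y + e y · x
    e-u       : ∀ x (p : x ≢ e x) → e (u x p) ≡ e x · inv x p
    distrib   : ∀ x y z → x · y + x · z ≡ x · (y + z) + e x · y + e x · z
    neg-·     : ∀ x y → - (x · y) ≡ (- x) · y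
    𝟎         : S
    𝟎-id      : ∀ x → 𝟎 + x ≡ x
    𝟏         : S
    𝟏-id      : ∀ x → 𝟏 · x ≡ x
    M         : S
    M-max     : ∀ x → e x + M ≡ M
    nontrivial : Σ S (λ x → (e x ≢ 𝟎) × (e x ≢ M))
    decomp    : ∀ x → Σ S (λ a → (x ≡ a + e x) × (e a ≡ 𝟎))
    dense     : ∀ x y → x ≡ e x → y ≡ e y → x < y →
                Σ S (λ z → (z ≢ e z) × (x < z) × (z < y))

-- Axiom (4) says x(y + z) + e(x)y + e(x)z = xy + xz, and each e(x)y is a
-- magnitude; adding a magnitude never decreases an element, since 0 ≤ e(c)
-- (0 is absorbed by every magnitude).
module Submission where

open import Level using (Level)
open import Data.Product using (proj₁; _,_)
open import Relation.Binary.PropositionalEquality using (subst; subst₂; sym)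
open import Relation.Binary.Structures using (IsTotalOrder)
open import Defs

module _ {a ℓ : Level} (𝕊 : Solid a ℓ) where
  open Solid 𝕊

  𝟎≤e : ∀ c → 𝟎 ≤ e c
  𝟎≤e c = proj₁ (absorbed c 𝟎 (𝟎-id (e c)))

  ≤-+-e : ∀ w c → w ≤ w + e c
  ≤-+-e w c = subst₂ _≤_ (𝟎-id w) (+-comm (e c) w) (+-mono-≤ 𝟎 (e c) w (𝟎≤e c))

  ≤-+-e· : ∀ w x y → w ≤ w + e x · y
  ≤-+-e· w x y with e·-mag x y
  ... | c , e·≡e = subst (λ t → w ≤ w + t) (sym e·≡e) (≤-+-e w c)

theorem4p3 : ∀ {a ℓ : Level} (𝕊 : Solid a ℓ) → let open Solid 𝕊 in
    ∀ (x y z : S) → x · (y + z) ≤ x · y + x · z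
theorem4p3 𝕊 x y z =
  subst (x · (y + z) ≤_) (sym (distrib x y z))
    (trans (≤-+-e· 𝕊 (x · (y + z)) x y) (≤-+-e· 𝕊 (x · (y + z) + e x · y) x z))
  where
    open Solid 𝕊
    open IsTotalOrder ≤-isTotalOrder using (trans)
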